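{- Let $\gamma>0$ and $\alpha$ be ordinals below $\varepsilon_0$ in Cantor normal form, and let $h:\mathbb{N}\to\mathbb{N}$ be monotone and eventually bounded by a function in $\mathscr{F}_\gamma$. Then (i) if $\alpha<\omega$, the function $f_\alpha$ is bounded by a function in $\mathscr{F}_{\gamma+\alpha}$; (ii) if $\gamma<\omega$ and $\alpha\geq\omega$, the function $f_\alpha$ is bounded by a function in $\mathscr{F}_\alpha$. (Here "bounded by a function in $\mathscr{F}$" means there is $f\in\mathscr{F}$ with $f_\alpha(x)\leq f(x)$ for all $x$; "eventually bounded" means such an inequality holds for all sufficiently large $x$.)
   Context: Fundamental sequences with $\omega_x=x$: $(\delta+\omega^{\beta+1})_x=\delta+\omega^\beta\cdot x$, $(\delta+\omega^{\lambda})_x=\delta+\omega^{\lambda_x}$. Fast-growing hierarchy relative to control $h$: $f_0(x)=h(x)$, $f_{\beta+1}(x)=f_\beta^{x}(x)$ ($x$-fold iterate), $f_\lambda(x)=f_{\lambda_x}(x)$. The standard version $F_\beta$ is the case $h(x)=x+1$. $\mathscr{F}_\beta$ (extended Grzegorczyk class) is the closure of constant functions, addition, projections and $F_\beta$ under substitution and limited recursion (if $h_1,h_2,h_3$ are in the class, so is $f$ with $f(0,\vec x)=h_1(\vec x)$, $f(y+1,\vec x)=h_2(y,\vec x,f(y,\vec x))$, $f(y,\vec x)\leq h_3(y,\vec x)$). -}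

module Defs where

open import Data.Nat using (ℕ; zero; suc; _+_; _≤_)
open import Data.Fin using (Fin)
open import Data.Vec using (Vec; []; _∷_; _∷ʳ_; lookup; head; tail)
open import Data.Sum using (_⊎_)
open import Relation.Binary.PropositionalEquality using (_≡_)

-- Ordinals below ε₀ in Cantor normal form (term representation).
-- ω^ a + b  denotes  ω^a + b ; normal form requires the leading
-- exponent of b to be ≤ a (see IsNF).

infixr 6 ω^_+_
data Ord : Set where
  𝟎     : Ord
  ω^_+_ : Ord → Ord → Ord

data Cmp : Set where
  lt eq gt : Cmp

cmp : Ord → Ord → Cmp
cmp 𝟎 𝟎 = eq
cmp 𝟎 (ω^ _ + _) = lt
cmp (ω^ _ + _) 𝟎 = gt
cmp (ω^ a + b) (ω^ c + d) with cmp a c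
... | lt = lt
... | gt = gt
... | eq = cmp b d

infix 4 _<ₒ_ _≤ₒ_
_<ₒ_ : Ord → Ord → Set
a <ₒ b = cmp a b ≡ lt

_≤ₒ_ : Ord → Ord → Set
a ≤ₒ b = a <ₒ b ⊎ a ≡ b

HeadLe : Ord → Ord → Set
HeadLe 𝟎 a = ⊤′
  where open import Data.Unit using () renaming (⊤ to ⊤′)
HeadLe (ω^ c + _) a = c ≤ₒ a

data IsNF : Ord → Set where
  nf-𝟎 : IsNF 𝟎
  nf-ω : ∀ {a b} → IsNF a → IsNF b → HeadLe b a → IsNF (ω^ a + b)

nat : ℕ → Ord
nat zero    = 𝟎
nat (suc n) = ω^ 𝟎 + nat n

ω : Ord
ω = ω^ (ω^ 𝟎 + 𝟎) + 𝟎

infixl 6 _⊕_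
_⊕_ : Ord → Ord → Ord
𝟎 ⊕ β = β
(ω^ a + b) ⊕ 𝟎 = ω^ a + b
(ω^ a + b) ⊕ (ω^ c + d) with cmp a c
... | lt = ω^ c + d
... | _  = ω^ a + (b ⊕ (ω^ c + d))

data Kind : Set where
  isZero : Kind
  isSucc : Ord → Kind
  isLim  : Kind

kind : Ord → Kind
kind 𝟎 = isZero
kind (ω^ 𝟎 + 𝟎) = isSucc 𝟎
kind (ω^ (ω^ _ + _) + 𝟎) = isLim
kind (ω^ a + (ω^ c + d)) with kind (ω^ c + d)
... | isZero   = isZero
... | isSucc p = isSucc (ω^ a + p)
... | isLim    = isLim

ω^_·_ : Ord → ℕ → Ord
ω^ β · zero  = 𝟎
ω^ β · suc x = ω^ β + (ω^ β · x)

-- Fundamental sequences (meaningful on limits):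
--   (δ + ω^(β+1))_x = δ + ω^β · x ,  (δ + ω^λ)_x = δ + ω^(λ_x).
mutual
  fs : Ord → ℕ → Ord
  fs 𝟎 x = 𝟎
  fs (ω^ a + 𝟎) x = fsω a x
  fs (ω^ a + (ω^ c + d)) x = ω^ a + fs (ω^ c + d) x

  fsω : Ord → ℕ → Ord
  fsω a x with kind a
  ... | isZero   = 𝟎
  ... | isSucc p = ω^ p · x
  ... | isLim    = ω^ fs a x + 𝟎

-- Fast-growing hierarchy relative to a control function h, given by
-- its graph:  FG h α x y  ⇔  f_α(x) = y ;  It h β n x y ⇔ f_β^n(x) = y.

mutual
  data FG (h : ℕ → ℕ) : Ord → ℕ → ℕ → Set where
    fg-zero : ∀ {x} → FG h 𝟎 x (h x)
    fg-succ : ∀ {α β x y} → kind α ≡ isSucc β → It h β x x y → FG h α x y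
    fg-lim  : ∀ {α x y} → kind α ≡ isLim → FG h (fs α x) x y → FG h α x y

  data It (h : ℕ → ℕ) (β : Ord) : ℕ → ℕ → ℕ → Set where
    it-zero : ∀ {x} → It h β zero x x
    it-suc  : ∀ {n x y z} → FG h β x y → It h β n y z → It h β (suc n) x z

F-graph : Ord → ℕ → ℕ → Set
F-graph = FG suc

data 𝓕 (β : Ord) : {k : ℕ} → (Vec ℕ k → ℕ) → Set where
  const : ∀ {k} (c : ℕ) → 𝓕 β {k} (λ _ → c)
  add   : 𝓕 β {2} (λ v → head v + head (tail v))
  proj  : ∀ {k} (i : Fin k) → 𝓕 β {k} (λ v → lookup v i)
  Fβ    : (g : Vec ℕ 1 → ℕ) → (∀ x → F-graph β x (g (x ∷ []))) → 𝓕 β {1} g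
  subst : ∀ {k m} {g : Vec ℕ m → ℕ} {hs : Fin m → Vec ℕ k → ℕ} →
          𝓕 β g → (∀ i → 𝓕 β (hs i)) →
          𝓕 β {k} (λ v → g (Data.Vec.tabulate (λ i → hs i v)))
  limrec : ∀ {k} {h₁ : Vec ℕ k → ℕ} {h₂ : Vec ℕ (suc (suc k)) → ℕ}
             {h₃ : Vec ℕ (suc k) → ℕ} (f : Vec ℕ (suc k) → ℕ) →
           𝓕 β h₁ → 𝓕 β h₂ → 𝓕 β h₃ →
           (∀ xs → f (0 ∷ xs) ≡ h₁ xs) →
           (∀ y xs → f (suc y ∷ xs) ≡ h₂ (y ∷ (xs ∷ʳ f (y ∷ xs)))) →
           (∀ v → f v ≤ h₃ v) →
           𝓕 β f
  ext   : ∀ {k} {f g : Vec ℕ k → ℕ} → 𝓕 β f → (∀ v → f v ≡ g v) → 𝓕 β g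

BoundedIn : (h : ℕ → ℕ) → Ord → Ord → Set
BoundedIn h α β =
  Σ (Vec ℕ 1 → ℕ) λ f → 𝓕 β f × (∀ x y → FG h α x y → y ≤ f (x ∷ []))
  where open import Data.Product using (Σ; _×_)

module Submission where

-- Everything is measured against the standard hierarchy F_β, which we first
-- realise as a total function (by well-founded recursion along descent steps
-- β → predecessor / β → β[y]) and equip with its basic properties: F_β is
-- inflationary and strictly monotone, and F_δ(z) ≤ F_β(z) whenever β descends
-- to δ by steps with arguments in [1, z]; the latter rests on the Bachmann
-- property λ[x+1] ⇝ λ[x].  Every function of 𝓕_β (β ≠ 0) is dominated by an
-- iterate F_β^m(Σx + m), so an h eventually below a member of 𝓕_γ satisfies
-- h(x) ≤ F_γ^K(x + K) everywhere.
--
-- (i) For finite α = n, induction on n bounds f_n by F_{γ+n}^K(x + K): the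
--     x-fold iterate of such a bound is dominated one level up.
-- (ii) For finite γ, the control is absorbed two levels up, h(x) + c ≤ F_p(x + c);
--     relativising gives f_α(x) + c ≤ F_{p+α}(x + c), and for α ≥ ω the left
--     padding p is absorbed: F_{p+α}(z) + p ≤ F_α(z + p).

open import Defs
open import Data.Nat using (ℕ; zero; suc; _+_; _*_; _≤_; _<_; z≤n; s≤s; _≤′_; ≤′-refl; ≤′-step)
open import Data.Nat.Properties
open import Data.Fin using (Fin; zero; suc)
open import Data.Vec using (Vec; []; _∷_; lookup; tabulate; sum; head)
open import Data.Vec.Properties using (lookup∘tabulate)
open import Data.Empty using (⊥; ⊥-elim)
open import Data.Unit using (⊤; tt)
open import Data.Sum using (_⊎_; inj₁; inj₂)
open import Data.Product using (Σ; _×_; _,_; proj₁; proj₂)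
open import Relation.Binary.PropositionalEquality
  using (_≡_; refl; sym; trans; cong; subst₂; module ≡-Reasoning) renaming (subst to ≡-subst)
open import Relation.Binary.Construct.Closure.ReflexiveTransitive
  using (Star; ε; _◅_; _◅◅_; gmap; kleisliStar) renaming (map to star-map)
open import Induction.WellFounded using (Acc; acc)

liftK : Ord → Kind → Kind
liftK a isZero     = isZero
liftK a (isSucc p) = isSucc (ω^ a + p)
liftK a isLim      = isLim

kind-cons : ∀ a c d → kind (ω^ a + (ω^ c + d)) ≡ liftK a (kind (ω^ c + d))
kind-cons 𝟎 c d with kind (ω^ c + d)
... | isZero   = refl
... | isSucc p = refl
... | isLim    = refl
kind-cons (ω^ _ + _) c d with kind (ω^ c + d)
... | isZero   = refl
... | isSucc p = refl
... | isLim    = refl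

liftK-isSucc : ∀ a k {β'} → liftK a k ≡ isSucc β' →
               Σ Ord λ p → (k ≡ isSucc p) × (β' ≡ ω^ a + p)
liftK-isSucc a (isSucc p) refl = p , refl , refl

liftK-isLim : ∀ a k → liftK a k ≡ isLim → k ≡ isLim
liftK-isLim a isLim _ = refl

kind-nonzero : ∀ a b → kind (ω^ a + b) ≡ isZero → ⊥
kind-nonzero 𝟎 𝟎 ()
kind-nonzero (ω^ _ + _) 𝟎 ()
kind-nonzero a (ω^ c + d) e = go (kind (ω^ c + d)) refl (trans (sym (kind-cons a c d)) e)
  where
    go : ∀ k → kind (ω^ c + d) ≡ k → liftK a k ≡ isZero → ⊥
    go isZero q _ = kind-nonzero c d q

kind-isZero : ∀ β → kind β ≡ isZero → β ≡ 𝟎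
kind-isZero 𝟎 _ = refl
kind-isZero (ω^ a + b) e = ⊥-elim (kind-nonzero a b e)

kind-prefix-succ : ∀ a {β β'} → kind β ≡ isSucc β' → kind (ω^ a + β) ≡ isSucc (ω^ a + β')
kind-prefix-succ a {ω^ c + d} q = trans (kind-cons a c d) (cong (liftK a) q)

kind-prefix-lim : ∀ a {β} → kind β ≡ isLim → kind (ω^ a + β) ≡ isLim
kind-prefix-lim a {ω^ c + d} q = trans (kind-cons a c d) (cong (liftK a) q)

fs-prefix : ∀ a {β} x → kind β ≡ isLim → fs (ω^ a + β) x ≡ ω^ a + fs β x
fs-prefix a {ω^ c + d} x q = refl

fsω-succ : ∀ {a p} x → kind a ≡ isSucc p → fsω a x ≡ ω^ p · x
fsω-succ {a} x e rewrite e = refl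

fsω-lim : ∀ {a} x → kind a ≡ isLim → fsω a x ≡ ω^ fs a x + 𝟎
fsω-lim {a} x e rewrite e = refl

data Step (y : ℕ) : Ord → Ord → Set where
  step-succ : ∀ {β β'} → kind β ≡ isSucc β' → Step y β β'
  step-lim  : ∀ {β} → kind β ≡ isLim → Step y β (fs β y)

step-lim≡ : ∀ {y β X} → kind β ≡ isLim → fs β y ≡ X → Step y β X
step-lim≡ q refl = step-lim q

step-prefix : ∀ {y β β'} a → Step y β β' → Step y (ω^ a + β) (ω^ a + β')
step-prefix a (step-succ e) = step-succ (kind-prefix-succ a e)
step-prefix {y} {β} a (step-lim e) = step-lim≡ (kind-prefix-lim a e) (fs-prefix a {β} y e)

step-cons-inv : ∀ {y a c d β'} → Step y (ω^ a + (ω^ c + d)) β' →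
                Σ Ord λ β'' → (β' ≡ ω^ a + β'') × Step y (ω^ c + d) β''
step-cons-inv {a = a} {c} {d} (step-succ e)
  with liftK-isSucc a (kind (ω^ c + d)) (trans (sym (kind-cons a c d)) e)
... | p , q , refl = p , refl , step-succ q
step-cons-inv {a = a} {c} {d} (step-lim e) =
  _ , refl , step-lim (liftK-isLim a _ (trans (sym (kind-cons a c d)) e))

data StepPower (y : ℕ) (a : Ord) : Ord → Set where
  power-zero : a ≡ 𝟎 → StepPower y a 𝟎
  power-succ : ∀ {p} → kind a ≡ isSucc p → StepPower y a (ω^ p · y)
  power-lim  : kind a ≡ isLim → StepPower y a (ω^ fs a y + 𝟎)

step-power-inv : ∀ {y a β'} → Step y (ω^ a + 𝟎) β' → StepPower y a β'
step-power-inv {a = 𝟎} (step-succ refl) = power-zero refl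
step-power-inv {y} {a = ω^ c + d} (step-lim e) with kind (ω^ c + d) in q
... | isZero   = ⊥-elim (kind-nonzero c d q)
... | isSucc p = power-succ q
... | isLim    = power-lim q

_◁_ : Ord → Ord → Set
β' ◁ β = Σ ℕ λ y → Step y β β'

acc-𝟎 : Acc _◁_ 𝟎
acc-𝟎 = acc λ { (_ , step-succ ()) ; (_ , step-lim ()) }

mutual
  acc-cons : ∀ a → Acc _◁_ a → ∀ b → Acc _◁_ b → Acc _◁_ (ω^ a + b)
  acc-cons a (acc ra) 𝟎 _ = acc λ { (y , st) → acc-power a ra y (step-power-inv st) }
  acc-cons a aa (ω^ c + d) (acc rb) = acc λ { (y , st) → acc-tail a aa rb y (step-cons-inv st) }

  acc-power : ∀ a → (∀ {z} → z ◁ a → Acc _◁_ z) → ∀ y {β'} → StepPower y a β' → Acc _◁_ β'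
  acc-power a ra y (power-zero _) = acc-𝟎
  acc-power a ra y (power-succ {p} e) = acc-multiple p (ra (y , step-succ e)) y
  acc-power a ra y (power-lim e) = acc-cons (fs a y) (ra (y , step-lim e)) 𝟎 acc-𝟎

  acc-tail : ∀ a → Acc _◁_ a → ∀ {b} → (∀ {z} → z ◁ b → Acc _◁_ z) → ∀ y {β'} →
             (Σ Ord λ β'' → (β' ≡ ω^ a + β'') × Step y b β'') → Acc _◁_ β'
  acc-tail a aa rb y (b'' , refl , st) = acc-cons a aa b'' (rb (y , st))

  acc-multiple : ∀ p → Acc _◁_ p → ∀ n → Acc _◁_ (ω^ p · n)
  acc-multiple p ap zero    = acc-𝟎
  acc-multiple p ap (suc n) = acc-cons p ap (ω^ p · n) (acc-multiple p ap n)

◁-wf : ∀ β → Acc _◁_ β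
◁-wf 𝟎 = acc-𝟎
◁-wf (ω^ a + b) = acc-cons a (◁-wf a) b (◁-wf b)

descend : ∀ y β → Star (Step y) β 𝟎
descend y β = go β (◁-wf β)
  where
    go : ∀ β → Acc _◁_ β → Star (Step y) β 𝟎
    go β (acc rs) with kind β in q
    ... | isZero rewrite kind-isZero β q = ε
    ... | isSucc β' = step-succ q ◅ go β' (rs (y , step-succ q))
    ... | isLim     = step-lim q ◅ go (fs β y) (rs (y , step-lim q))

multiple-descend : ∀ y p n → Star (Step y) (ω^ p · suc n) (ω^ p · n)
multiple-descend y p zero    = descend y (ω^ p + 𝟎)
multiple-descend y p (suc n) = gmap (ω^ p +_) (step-prefix p) (multiple-descend y p n)

exponent-descend : ∀ {y e e'} → Step (suc y) e e' → Star (Step (suc y)) (ω^ e + 𝟎) (ω^ e' + 𝟎)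
exponent-descend {y} {ω^ c + d} {e'} (step-succ q) =
  step-lim≡ refl (fsω-succ {ω^ c + d} (suc y) q)
    ◅ gmap (ω^ e' +_) (step-prefix e') (descend (suc y) (ω^ e' · y))
exponent-descend {y} {ω^ c + d} (step-lim q) = step-lim≡ refl (fsω-lim {ω^ c + d} (suc y) q) ◅ ε

bachmann-power : ∀ c d x → let a = ω^ c + d in
                 (kind a ≡ isLim → Star (Step (suc x)) (fs a (suc x)) (fs a x)) →
                 ∀ k → kind a ≡ k → Star (Step (suc x)) (fsω a (suc x)) (fsω a x)
bachmann-power c d x bach-a isZero e = ⊥-elim (kind-nonzero c d e)
bachmann-power c d x bach-a (isSucc p) e =
  subst₂ (Star (Step (suc x))) (sym (fsω-succ {ω^ c + d} (suc x) e)) (sym (fsω-succ {ω^ c + d} x e))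
    (multiple-descend (suc x) p x)
bachmann-power c d x bach-a isLim e =
  subst₂ (Star (Step (suc x))) (sym (fsω-lim {ω^ c + d} (suc x) e)) (sym (fsω-lim {ω^ c + d} x e))
    (kleisliStar (λ e → ω^ e + 𝟎) exponent-descend (bach-a e))

bachmann : ∀ λ′ x → kind λ′ ≡ isLim → Star (Step (suc x)) (fs λ′ (suc x)) (fs λ′ x)
bachmann (ω^ a + b@(ω^ c + d)) x q =
  gmap (ω^ a +_) (step-prefix a) (bachmann b x (liftK-isLim a _ (trans (sym (kind-cons a c d)) q)))
bachmann (ω^ a@(ω^ c + d) + 𝟎) x _ = bachmann-power c d x (bachmann a x) (kind a) refl

BoundedStep : ℕ → Ord → Ord → Set
BoundedStep z β β' = Σ ℕ λ y → (1 ≤ y) × (y ≤ z) × Step y β β'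

Chain : ℕ → Ord → Ord → Set
Chain z = Star (BoundedStep z)

bachmann-chain : ∀ {λ′ x z} → kind λ′ ≡ isLim → x ≤ z → Chain z (fs λ′ z) (fs λ′ x)
bachmann-chain {λ′} q x≤z = go (≤⇒≤′ x≤z)
  where
    go : ∀ {x z} → x ≤′ z → Chain z (fs λ′ z) (fs λ′ x)
    go ≤′-refl = ε
    go {z = suc z} (≤′-step p) =
      star-map (λ st → suc z , s≤s z≤n , ≤-refl , st) (bachmann λ′ z q)
        ◅◅ star-map (λ { (y , 1≤y , y≤z , st) → y , 1≤y , m≤n⇒m≤1+n y≤z , st }) (go p)

iter : (ℕ → ℕ) → ℕ → ℕ → ℕ
iter f zero    x = x
iter f (suc n) x = iter f n (f x)

iter-suc : ∀ f n x → iter f (suc n) x ≡ f (iter f n x)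
iter-suc f zero    x = refl
iter-suc f (suc n) x = iter-suc f n (f x)

iter-add : ∀ f n m x → iter f (n + m) x ≡ iter f m (iter f n x)
iter-add f zero    m x = refl
iter-add f (suc n) m x = iter-add f n m (f x)

Mono : (ℕ → ℕ) → Set
Mono f = ∀ {a b} → a ≤ b → f a ≤ f b

Infl : (ℕ → ℕ) → Set
Infl f = ∀ u → u ≤ f u

StrictlyMono : (ℕ → ℕ) → Set
StrictlyMono f = ∀ w → f w < f (suc w)

strictlyMono⇒mono : ∀ f → StrictlyMono f → Mono f
strictlyMono⇒mono f s a≤b = go (≤⇒≤′ a≤b)
  where
    go : ∀ {a b} → a ≤′ b → f a ≤ f b
    go ≤′-refl     = ≤-refl
    go (≤′-step p) = ≤-trans (go p) (<⇒≤ (s _))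

iter-infl : ∀ f → Infl f → ∀ n x → x ≤ iter f n x
iter-infl f i zero    x = ≤-refl
iter-infl f i (suc n) x = ≤-trans (i x) (iter-infl f i n (f x))

iter-mono : ∀ f → Mono f → ∀ n {a b} → a ≤ b → iter f n a ≤ iter f n b
iter-mono f m zero    a≤b = a≤b
iter-mono f m (suc n) a≤b = iter-mono f m n (m a≤b)

iter-mono-count : ∀ f → Infl f → ∀ {m n} x → m ≤ n → iter f m x ≤ iter f n x
iter-mono-count f i x m≤n = go (≤⇒≤′ m≤n)
  where
    go : ∀ {m n} → m ≤′ n → iter f m x ≤ iter f n x
    go ≤′-refl = ≤-refl
    go {n = suc n} (≤′-step p) =
      ≤-trans (go p) (≤-trans (i _) (≤-reflexive (sym (iter-suc f n x))))

iter-mono₂ : ∀ f → Infl f → Mono f → ∀ {m n a b} → m ≤ n → a ≤ b → iter f m a ≤ iter f n b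
iter-mono₂ f i mo {m} {n} {a} {b} m≤n a≤b =
  ≤-trans (iter-mono f mo m a≤b) (iter-mono-count f i b m≤n)

iter-linear : ∀ f → (∀ u → 1 ≤ u → u < f u) → ∀ n u → 1 ≤ u → u + n ≤ iter f n u
iter-linear f s zero    u _ = ≤-reflexive (+-identityʳ u)
iter-linear f s (suc n) u p =
  begin
    u + suc n          ≡⟨ +-suc u n ⟩
    suc u + n          ≤⟨ +-monoˡ-≤ n (s u p) ⟩
    f u + n            ≤⟨ iter-linear f s n (f u) (≤-trans p (<⇒≤ (s u p))) ⟩
    iter f n (f u)     ∎
  where open ≤-Reasoning

iter-compare : ∀ Ψ Φ j → (∀ u → 1 ≤ u → Ψ u ≤ iter Φ j u) → Mono Ψ → Infl Φ →
               ∀ n u → 1 ≤ u → iter Ψ n u ≤ iter Φ (n * j) u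
iter-compare Ψ Φ j B mΨ iΦ zero    u _ = ≤-refl
iter-compare Ψ Φ j B mΨ iΦ (suc n) u p =
  begin
    iter Ψ n (Ψ u)              ≤⟨ iter-mono Ψ mΨ n (B u p) ⟩
    iter Ψ n (iter Φ j u)       ≤⟨ iter-compare Ψ Φ j B mΨ iΦ n (iter Φ j u) (≤-trans p (iter-infl Φ iΦ j u)) ⟩
    iter Φ (n * j) (iter Φ j u) ≡⟨ sym (iter-add Φ j (n * j) u) ⟩
    iter Φ (j + n * j) u        ∎
  where open ≤-Reasoning

iter-shift : ∀ G H K → (∀ w → G w + K ≤ H (w + K)) → Mono H →
             ∀ n a → iter G n a + K ≤ iter H n (a + K)
iter-shift G H K s m zero    a = ≤-refl
iter-shift G H K s m (suc n) a = ≤-trans (iter-shift G H K s m n (G a)) (iter-mono H m n (s a))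


fg-total : ∀ h β → Acc _◁_ β → ∀ x → Σ ℕ (FG h β x)
fg-total h β (acc rs) x with kind β in q
... | isZero = h x , ≡-subst (λ b → FG h b x (h x)) (sym (kind-isZero β q)) fg-zero
... | isSucc β' = proj₁ it , fg-succ q (proj₂ it)
  where
    it-total : ∀ n x → Σ ℕ (It h β' n x)
    it-total zero    x = x , it-zero
    it-total (suc n) x =
      let (y , d) = fg-total h β' (rs (0 , step-succ q)) x
          (w , i) = it-total n y
      in w , it-suc d i
    it = it-total x x
... | isLim = proj₁ d , fg-lim q (proj₂ d)
  where d = fg-total h (fs β x) (rs (x , step-lim q)) x

mutual
  fg-functional : ∀ {h α x y y'} → FG h α x y → FG h α x y' → y ≡ y'
  fg-functional fg-zero fg-zero = refl
  fg-functional fg-zero (fg-succ () _)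
  fg-functional fg-zero (fg-lim () _)
  fg-functional (fg-succ () _) fg-zero
  fg-functional (fg-lim () _) fg-zero
  fg-functional (fg-succ e i) (fg-succ e' i') with trans (sym e) e'
  ... | refl = it-functional i i'
  fg-functional (fg-succ e _) (fg-lim e' _) with trans (sym e) e'
  ... | ()
  fg-functional (fg-lim e _) (fg-succ e' _) with trans (sym e) e'
  ... | ()
  fg-functional (fg-lim e d) (fg-lim e' d') = fg-functional d d'

  it-functional : ∀ {h β n x y y'} → It h β n x y → It h β n x y' → y ≡ y'
  it-functional it-zero it-zero = refl
  it-functional (it-suc d i) (it-suc d' i') with fg-functional d d'
  ... | refl = it-functional i i'

F : Ord → ℕ → ℕ
F β x = proj₁ (fg-total suc β (◁-wf β) x)

F-graph-F : ∀ β x → FG suc β x (F β x)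
F-graph-F β x = proj₂ (fg-total suc β (◁-wf β) x)

iter-graph-F : ∀ β n a → It suc β n a (iter (F β) n a)
iter-graph-F β zero    a = it-zero
iter-graph-F β (suc n) a = it-suc (F-graph-F β a) (iter-graph-F β n (F β a))

F-zero : ∀ x → F 𝟎 x ≡ suc x
F-zero x = fg-functional (F-graph-F 𝟎 x) fg-zero

F-succ : ∀ β {β'} → kind β ≡ isSucc β' → ∀ x → F β x ≡ iter (F β') x x
F-succ β {β'} q x = fg-functional (F-graph-F β x) (fg-succ q (iter-graph-F β' x x))

F-lim : ∀ β → kind β ≡ isLim → ∀ x → F β x ≡ F (fs β x) x
F-lim β q x = fg-functional (F-graph-F β x) (fg-lim q (F-graph-F (fs β x) x))

F-infl-strict : ∀ β → Acc _◁_ β → ∀ x → (x ≤ F β x) × (1 ≤ x → x < F β x)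
F-infl-strict β (acc rs) x with kind β in q
... | isZero rewrite kind-isZero β q | F-zero x = n≤1+n x , λ _ → ≤-refl
... | isSucc β' rewrite F-succ β q x = iter-infl (F β') infl′ x x , strict x
  where
    IH = F-infl-strict β' (rs (0 , step-succ q))
    infl′ : Infl (F β')
    infl′ u = proj₁ (IH u)
    strict : ∀ x → 1 ≤ x → x < iter (F β') x x
    strict (suc x) _ = <-≤-trans (proj₂ (IH (suc x)) (s≤s z≤n)) (iter-infl (F β') infl′ x _)
... | isLim rewrite F-lim β q x = F-infl-strict (fs β x) (rs (x , step-lim q)) x

F-infl : ∀ β → Infl (F β)
F-infl β x = proj₁ (F-infl-strict β (◁-wf β) x)

F-infl-pos : ∀ β x → 1 ≤ x → x < F β x
F-infl-pos β x = proj₂ (F-infl-strict β (◁-wf β) x)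

-- Proved together with strict
-- monotonicity of F_β, by well-founded induction on β.
DescentMono : Ord → Set
DescentMono β = ∀ {z δ} → Chain z β δ → F δ z ≤ F β z

F-mono-chain : ∀ β → Acc _◁_ β → StrictlyMono (F β) × DescentMono β
F-mono-chain β (acc rs) = strict , chain
  where
    IH : ∀ {β'} y → Step y β β' → StrictlyMono (F β') × DescentMono β'
    IH y st = F-mono-chain _ (rs (y , st))

    step : ∀ {y z β'} → Step y β β' → 1 ≤ y → y ≤ z → F β' z ≤ F β z
    step {z = zero} (step-succ _) (s≤s _) ()
    step {z = suc z} {β'} (step-succ q) _ _ =
      ≤-trans (iter-infl (F β') (F-infl β') z (F β' (suc z))) (≤-reflexive (sym (F-succ β q (suc z))))
    step {y} {z} (step-lim q) _ y≤z =
      ≤-trans (proj₂ (IH z (step-lim q)) (bachmann-chain {β} q y≤z)) (≤-reflexive (sym (F-lim β q z)))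

    chain : DescentMono β
    chain ε = ≤-refl
    chain ((y , 1≤y , y≤z , st) ◅ rest) = ≤-trans (proj₂ (IH y st) rest) (step st 1≤y y≤z)

    strict : StrictlyMono (F β)
    strict w with kind β in q
    ... | isZero rewrite kind-isZero β q | F-zero w | F-zero (suc w) = n<1+n (suc w)
    ... | isSucc β' =
      begin-strict
        F β w                        ≡⟨ F-succ β q w ⟩
        iter (F β') w w              ≤⟨ iter-mono (F β') mono′ w (n≤1+n w) ⟩
        iter (F β') w (suc w)        <⟨ F-infl-pos β' _ 1≤it ⟩
        F β' (iter (F β') w (suc w)) ≡⟨ sym (iter-suc (F β') w (suc w)) ⟩
        iter (F β') (suc w) (suc w)  ≡⟨ sym (F-succ β q (suc w)) ⟩
        F β (suc w)                  ∎
      where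
        open ≤-Reasoning
        mono′ : Mono (F β')
        mono′ = strictlyMono⇒mono (F β') (proj₁ (IH 0 (step-succ q)))
        1≤it : 1 ≤ iter (F β') w (suc w)
        1≤it = ≤-trans (s≤s z≤n) (iter-infl (F β') (F-infl β') w (suc w))
    ... | isLim =
      begin-strict
        F β w                    ≡⟨ F-lim β q w ⟩
        F (fs β w) w             <⟨ proj₁ (IH w (step-lim q)) w ⟩
        F (fs β w) (suc w)       ≤⟨ proj₂ (IH (suc w) (step-lim q)) (bachmann-chain {β} q (n≤1+n w)) ⟩
        F (fs β (suc w)) (suc w) ≡⟨ sym (F-lim β q (suc w)) ⟩
        F β (suc w)              ∎
      where open ≤-Reasoning

F-strictlyMono : ∀ β → StrictlyMono (F β)
F-strictlyMono β = proj₁ (F-mono-chain β (◁-wf β))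

F-mono : ∀ β → Mono (F β)
F-mono β = strictlyMono⇒mono (F β) (F-strictlyMono β)

F-descent : ∀ β → DescentMono β
F-descent β = proj₂ (F-mono-chain β (◁-wf β))

-- Strict monotonicity lets an additive shift move inside: F_β(w) + k ≤ F_β(w + k).
F-shift : ∀ β w k → F β w + k ≤ F β (w + k)
F-shift β w zero = ≤-reflexive (trans (+-identityʳ _) (cong (F β) (sym (+-identityʳ w))))
F-shift β w (suc k) =
  begin
    F β w + suc k       ≡⟨ +-suc (F β w) k ⟩
    suc (F β w + k)     ≤⟨ s≤s (F-shift β w k) ⟩
    suc (F β (w + k))   ≤⟨ F-strictlyMono β (w + k) ⟩
    F β (suc (w + k))   ≡⟨ cong (F β) (sym (+-suc w k)) ⟩
    F β (w + suc k)     ∎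
  where open ≤-Reasoning

shiftedIter : Ord → ℕ → ℕ → ℕ
shiftedIter δ K w = iter (F δ) K (w + K)

shiftedIter-mono : ∀ δ K → Mono (shiftedIter δ K)
shiftedIter-mono δ K a≤b = iter-mono (F δ) (F-mono δ) K (+-monoˡ-≤ K a≤b)

shiftedIter-mono-count : ∀ δ {K K'} w → K ≤ K' → shiftedIter δ K w ≤ shiftedIter δ K' w
shiftedIter-mono-count δ w K≤K' = iter-mono₂ (F δ) (F-infl δ) (F-mono δ) K≤K' (+-monoʳ-≤ w K≤K')

shiftedIter-infl : ∀ δ K w → w + K ≤ shiftedIter δ K w
shiftedIter-infl δ K w = iter-infl (F δ) (F-infl δ) K (w + K)

NZ : Ord → Set
NZ 𝟎          = ⊥
NZ (ω^ _ + _) = ⊤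

successor-nonzero : ∀ β {β'} → kind β ≡ isSucc β' → NZ β
successor-nonzero (ω^ _ + _) _ = tt

fs-nonzero : ∀ β w → kind β ≡ isLim → NZ (fs β (suc w))
fs-nonzero (ω^ a + (ω^ c + d)) w _ = tt
fs-nonzero (ω^ a@(ω^ c + d) + 𝟎) w _ = power (kind a) refl
  where
    power : ∀ k → kind a ≡ k → NZ (fsω a (suc w))
    power isZero e = ⊥-elim (kind-nonzero c d e)
    power (isSucc p) e rewrite fsω-succ {a} (suc w) e = tt
    power isLim e rewrite fsω-lim {a} (suc w) e = tt

F-double : ∀ β → NZ β → ∀ w → w + w ≤ F β w
F-double β = go β (◁-wf β)
  where
    go : ∀ β → Acc _◁_ β → NZ β → ∀ w → w + w ≤ F β w
    go β _ nz zero = z≤n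
    go β (acc rs) nz (suc w) with kind β in q
    ... | isZero = ⊥-elim (≡-subst NZ (kind-isZero β q) nz)
    ... | isSucc β' =
      ≤-trans (iter-linear (F β') (F-infl-pos β') (suc w) (suc w) (s≤s z≤n))
              (≤-reflexive (sym (F-succ β q (suc w))))
    ... | isLim =
      ≤-trans (go (fs β (suc w)) (rs (suc w , step-lim q)) (fs-nonzero β w q) (suc w))
              (≤-reflexive (sym (F-lim β q (suc w))))

-- Doubling turns k-fold multiples into k iterations: k·u ≤ F_β^k(u) for β ≠ 𝟎.
F-multiple≤iter : ∀ β → NZ β → ∀ k u → k * u ≤ iter (F β) k u
F-multiple≤iter β nz zero    u = z≤n
F-multiple≤iter β nz (suc k) u =
  begin
    u + k * u                        ≤⟨ +-mono-≤ (iter-infl Φ (F-infl β) k u) (F-multiple≤iter β nz k u) ⟩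
    iter Φ k u + iter Φ k u          ≤⟨ F-double β nz _ ⟩
    Φ (iter Φ k u)                   ≡⟨ sym (iter-suc Φ k u) ⟩
    iter Φ (suc k) u                 ∎
  where
    open ≤-Reasoning
    Φ = F β

lookup≤sum : ∀ {k} (v : Vec ℕ k) i → lookup v i ≤ sum v
lookup≤sum (x ∷ v) zero    = m≤m+n x (sum v)
lookup≤sum (x ∷ v) (suc i) = ≤-trans (lookup≤sum v i) (m≤n+m (sum v) x)

sum-tabulate≤ : ∀ {m} (f : Fin m → ℕ) u → (∀ i → f i ≤ u) → sum (tabulate f) ≤ m * u
sum-tabulate≤ {zero}  f u p = z≤n
sum-tabulate≤ {suc m} f u p = +-mono-≤ (p zero) (sum-tabulate≤ (λ i → f (suc i)) u (λ i → p (suc i)))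

module Domination (β : Ord) (nz : NZ β) where
  Φ : ℕ → ℕ
  Φ = F β

  Dominated : ∀ {k} → (Vec ℕ k → ℕ) → Set
  Dominated {k} f = Σ ℕ λ m → ∀ v → f v ≤ shiftedIter β m (sum v)

  -- Substitution: with u = F_β^M'(Σv + M') for M' large, Σᵢ hᵢ(v) ≤ m·u and mg ≤ u,
  -- so g(h₁(v),…,h_m(v)) ≤ Φ^mg((m+1)·u) ≤ Φ^mg(Φ^(m+1)(u)) = Φ^N(Σv + M').
  dominated-subst : ∀ {k m} {g : Vec ℕ m → ℕ} {hs : Fin m → Vec ℕ k → ℕ} →
                    Dominated g → (∀ i → Dominated (hs i)) →
                    Dominated {k} (λ v → g (tabulate (λ i → hs i v)))
  dominated-subst {k} {m} {g} {hs} (mg , g≤) dhs = N , bound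
    where
      Ms = tabulate (λ i → proj₁ (dhs i))
      M' = sum Ms + mg
      N  = M' + suc m + mg

      Mᵢ≤M' : ∀ i → proj₁ (dhs i) ≤ M'
      Mᵢ≤M' i = ≤-trans (≡-subst (_≤ sum Ms) (lookup∘tabulate _ i) (lookup≤sum Ms i)) (m≤m+n _ mg)

      bound : ∀ v → g (tabulate (λ i → hs i v)) ≤ shiftedIter β N (sum v)
      bound v =
        begin
          g args                                    ≤⟨ g≤ args ⟩
          iter Φ mg (sum args + mg)                 ≤⟨ iter-mono Φ (F-mono β) mg (+-mono-≤ args≤ mg≤u) ⟩
          iter Φ mg (m * u + u)                     ≡⟨ cong (iter Φ mg) (+-comm (m * u) u) ⟩
          iter Φ mg (suc m * u)                     ≤⟨ iter-mono Φ (F-mono β) mg (F-multiple≤iter β nz (suc m) u) ⟩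
          iter Φ mg (iter Φ (suc m) u)              ≡⟨ cong (iter Φ mg) (sym (iter-add Φ M' (suc m) _)) ⟩
          iter Φ mg (iter Φ (M' + suc m) (s + M'))  ≡⟨ sym (iter-add Φ (M' + suc m) mg _) ⟩
          iter Φ N (s + M')                         ≤⟨ iter-mono Φ (F-mono β) N (+-monoʳ-≤ s M'≤N) ⟩
          shiftedIter β N s                         ∎
        where
          open ≤-Reasoning
          args = tabulate (λ i → hs i v)
          s = sum v
          u = shiftedIter β M' s
          M'≤N : M' ≤ N
          M'≤N = ≤-trans (m≤m+n M' (suc m)) (m≤m+n _ mg)
          mg≤u : mg ≤ u
          mg≤u = ≤-trans (m≤n+m mg _) (≤-trans (+-monoʳ-≤ s (m≤n+m mg _)) (shiftedIter-infl β M' s))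
          args≤ : sum args ≤ m * u
          args≤ = sum-tabulate≤ (λ i → hs i v) u λ i →
                    ≤-trans (proj₂ (dhs i) v) (shiftedIter-mono-count β s (Mᵢ≤M' i))

  dominated : ∀ {k} {f : Vec ℕ k → ℕ} → 𝓕 β f → Dominated f
  dominated (const c)  = c , λ v → ≤-trans (m≤n+m c (sum v)) (shiftedIter-infl β c (sum v))
  dominated add        = 0 , λ { (a ∷ b ∷ []) →
    ≤-reflexive (trans (cong (a +_) (sym (+-identityʳ b))) (sym (+-identityʳ _))) }
  dominated (proj i)   = 0 , λ v → ≤-trans (lookup≤sum v i) (≤-reflexive (sym (+-identityʳ _)))
  dominated (Fβ g g-graph) = 1 , λ { (x ∷ []) →
    ≤-trans (≤-reflexive (fg-functional (g-graph x) (F-graph-F β x)))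
            (F-mono β (≤-trans (m≤m+n x 0) (m≤m+n (x + 0) 1))) }
  dominated (subst dg dhs) = dominated-subst (dominated dg) (λ i → dominated (dhs i))
  dominated (limrec f _ _ d₃ _ _ f≤h₃) =
    proj₁ (dominated d₃) , λ v → ≤-trans (f≤h₃ v) (proj₂ (dominated d₃) v)
  dominated (ext d f≡g) =
    proj₁ (dominated d) , λ v → ≡-subst (_≤ _) (f≡g v) (proj₂ (dominated d) v)

kind-nat : ∀ k → kind (nat (suc k)) ≡ isSucc (nat k)
kind-nat zero    = refl
kind-nat (suc k) = kind-prefix-succ 𝟎 {nat (suc k)} (kind-nat k)

⊕-identityʳ : ∀ γ → γ ⊕ 𝟎 ≡ γ
⊕-identityʳ 𝟎          = refl
⊕-identityʳ (ω^ a + b) = refl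

⊕-nat-cons : ∀ a b k → (ω^ a + b) ⊕ nat k ≡ ω^ a + (b ⊕ nat k)
⊕-nat-cons a b zero = cong (ω^ a +_) (sym (⊕-identityʳ b))
⊕-nat-cons 𝟎 b (suc k) = refl
⊕-nat-cons (ω^ _ + _) b (suc k) = refl

kind-⊕-nat : ∀ γ k → kind (γ ⊕ nat (suc k)) ≡ isSucc (γ ⊕ nat k)
kind-⊕-nat 𝟎 k = kind-nat k
kind-⊕-nat (ω^ a + b) k rewrite ⊕-nat-cons a b (suc k) | ⊕-nat-cons a b k =
  kind-prefix-succ a (kind-⊕-nat b k)

positive-nonzero : ∀ γ → 𝟎 <ₒ γ → NZ γ
positive-nonzero (ω^ _ + _) _ = tt

headLe-𝟎-finite : ∀ b → IsNF b → HeadLe b 𝟎 → Σ ℕ λ m → b ≡ nat m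
headLe-𝟎-finite 𝟎 _ _ = 0 , refl
headLe-𝟎-finite (ω^ 𝟎 + b) (nf-ω _ nb hb) _ with headLe-𝟎-finite b nb hb
... | m , refl = suc m , refl
headLe-𝟎-finite (ω^ (ω^ _ + _) + b) _ (inj₁ ())

finite-below-ω : ∀ γ → IsNF γ → γ <ₒ ω → Σ ℕ λ m → γ ≡ nat m
finite-below-ω 𝟎 _ _ = 0 , refl
finite-below-ω (ω^ 𝟎 + b) (nf-ω _ nb hb) _ with headLe-𝟎-finite b nb hb
... | m , refl = suc m , refl
finite-below-ω (ω^ (ω^ 𝟎 + 𝟎) + 𝟎) _ ()
finite-below-ω (ω^ (ω^ 𝟎 + 𝟎) + (ω^ _ + _)) _ ()
finite-below-ω (ω^ (ω^ 𝟎 + (ω^ _ + _)) + b) _ ()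
finite-below-ω (ω^ (ω^ (ω^ _ + _) + _) + b) _ ()

Transfinite : Ord → Set
Transfinite 𝟎          = ⊥
Transfinite (ω^ a + _) = NZ a

ω≤⇒transfinite : ∀ α → ω ≤ₒ α → Transfinite α
ω≤⇒transfinite α (inj₂ refl) = tt
ω≤⇒transfinite 𝟎 (inj₁ ())
ω≤⇒transfinite (ω^ 𝟎 + _) (inj₁ ())
ω≤⇒transfinite (ω^ (ω^ _ + _) + _) _ = tt

transfinite-pred : ∀ β {β'} → Transfinite β → kind β ≡ isSucc β' → Transfinite β'
transfinite-pred (ω^ (ω^ _ + _) + 𝟎) _ ()
transfinite-pred (ω^ a + (ω^ c + d)) t q
  with liftK-isSucc a (kind (ω^ c + d)) (trans (sym (kind-cons a c d)) q)
... | _ , _ , refl = t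

kind-one : ∀ a → kind a ≡ isSucc 𝟎 → a ≡ ω^ 𝟎 + 𝟎
kind-one (ω^ 𝟎 + 𝟎) _ = refl
kind-one (ω^ a + (ω^ c + d)) q
  with liftK-isSucc a (kind (ω^ c + d)) (trans (sym (kind-cons a c d)) q)
... | _ , _ , ()

transfinite-fs : ∀ β z → Transfinite β → kind β ≡ isLim → (β ≡ ω) ⊎ Transfinite (fs β (suc z))
transfinite-fs (ω^ a + (ω^ c + d)) z t _ = inj₂ t
transfinite-fs (ω^ a@(ω^ c + d) + 𝟎) z _ _ = power (kind a) refl
  where
    power : ∀ k → kind a ≡ k → (ω^ a + 𝟎 ≡ ω) ⊎ Transfinite (fsω a (suc z))
    power isZero e = ⊥-elim (kind-nonzero c d e)
    power (isSucc 𝟎) e rewrite kind-one a e = inj₁ refl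
    power (isSucc (ω^ _ + _)) e rewrite fsω-succ {a} (suc z) e = inj₂ tt
    power isLim e rewrite fsω-lim {a} (suc z) e = inj₂ (fs-nonzero a z e)

-- Padding with k ones on the left: pad k β = 1 + ⋯ + 1 + β  (k + β, not normalised).
pad : ℕ → Ord → Ord
pad zero    β = β
pad (suc k) β = ω^ 𝟎 + pad k β

kind-pad-succ : ∀ k {β β'} → kind β ≡ isSucc β' → kind (pad k β) ≡ isSucc (pad k β')
kind-pad-succ zero    q = q
kind-pad-succ (suc k) {β} q = kind-prefix-succ 𝟎 {pad k β} (kind-pad-succ k {β} q)

kind-pad-lim : ∀ k {β} → kind β ≡ isLim → kind (pad k β) ≡ isLim
kind-pad-lim zero    q = q
kind-pad-lim (suc k) {β} q = kind-prefix-lim 𝟎 {pad k β} (kind-pad-lim k {β} q)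

fs-pad : ∀ k {β} x → kind β ≡ isLim → fs (pad k β) x ≡ pad k (fs β x)
fs-pad zero    x q = refl
fs-pad (suc k) {β} x q =
  trans (fs-prefix 𝟎 {pad k β} x (kind-pad-lim k {β} q)) (cong (ω^ 𝟎 +_) (fs-pad k {β} x q))

chain-pad : ∀ k {z β δ} → Chain z β δ → Chain z (pad k β) (pad k δ)
chain-pad k = gmap (pad k) (λ { (y , 1≤y , y≤z , st) → y , 1≤y , y≤z , step-pad k st })
  where
    step-pad : ∀ k {y β β'} → Step y β β' → Step y (pad k β) (pad k β')
    step-pad zero    st = st
    step-pad (suc k) st = step-prefix 𝟎 (step-pad k st)

pad-nat : ∀ k z → pad k (nat z) ≡ nat (k + z)
pad-nat zero    z = refl
pad-nat (suc k) z = cong (ω^ 𝟎 +_) (pad-nat k z)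

pad-𝟎 : ∀ k → pad k 𝟎 ≡ nat k
pad-𝟎 k = trans (pad-nat k 0) (cong nat (+-identityʳ k))

fs-ω : ∀ z → fs ω z ≡ nat z
fs-ω zero    = refl
fs-ω (suc z) = cong (ω^ 𝟎 +_) (fs-ω z)

-- F_{(k+1)+δ}(0) = 0: following limits at argument 0 ends at a successor, where
-- zero iterations are performed.
F-pad-zero : ∀ k δ → F (pad (suc k) δ) 0 ≡ 0
F-pad-zero k δ = go δ (◁-wf δ)
  where
    go : ∀ δ → Acc _◁_ δ → F (pad (suc k) δ) 0 ≡ 0
    go δ (acc rs) with kind δ in q
    ... | isZero =
      begin
        F (pad (suc k) δ) 0          ≡⟨ cong (λ e → F (pad (suc k) e) 0) (kind-isZero δ q) ⟩
        F (pad (suc k) 𝟎) 0          ≡⟨ cong (λ e → F e 0) (pad-𝟎 (suc k)) ⟩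
        F (nat (suc k)) 0            ≡⟨ F-succ (nat (suc k)) (kind-nat k) 0 ⟩
        0                            ∎
      where open ≡-Reasoning
    ... | isSucc δ' = F-succ (pad (suc k) δ) (kind-pad-succ (suc k) {δ} q) 0
    ... | isLim =
      begin
        F (pad (suc k) δ) 0          ≡⟨ F-lim (pad (suc k) δ) (kind-pad-lim (suc k) {δ} q) 0 ⟩
        F (fs (pad (suc k) δ) 0) 0   ≡⟨ cong (λ e → F e 0) (fs-pad (suc k) {δ} 0 q) ⟩
        F (pad (suc k) (fs δ 0)) 0   ≡⟨ go (fs δ 0) (rs (0 , step-lim q)) ⟩
        0                            ∎
      where open ≡-Reasoning

pad-absorb-ω : ∀ K z → F (pad K (fs ω z)) z + K ≤ F ω (z + K)
pad-absorb-ω K z =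
  begin
    F (pad K (fs ω z)) z + K  ≡⟨ cong (λ e → F (pad K e) z + K) (fs-ω z) ⟩
    F (pad K (nat z)) z + K   ≡⟨ cong (λ e → F e z + K) (pad-nat K z) ⟩
    F (nat (K + z)) z + K     ≤⟨ F-shift (nat (K + z)) z K ⟩
    F (nat (K + z)) (z + K)   ≡⟨ cong (λ n → F (nat n) (z + K)) (+-comm K z) ⟩
    F (nat (z + K)) (z + K)   ≡⟨ cong (λ e → F e (z + K)) (sym (fs-ω (z + K))) ⟩
    F (fs ω (z + K)) (z + K)  ≡⟨ sym (F-lim ω refl (z + K)) ⟩
    F ω (z + K)               ∎
  where open ≤-Reasoning

pad-absorb : ∀ β → Transfinite β → ∀ k z → F (pad k β) z + k ≤ F β (z + k)
pad-absorb β = go β (◁-wf β)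
  where
    go : ∀ β → Acc _◁_ β → Transfinite β → ∀ k z → F (pad k β) z + k ≤ F β (z + k)
    go β _ t zero z = F-shift β z 0
    go β (acc rs) t (suc k) z with kind β in q
    ... | isZero = ⊥-elim (≡-subst Transfinite (kind-isZero β q) t)
    ... | isSucc β' =
      begin
        F (pad K β) z + K            ≡⟨ cong (_+ K) (F-succ (pad K β) (kind-pad-succ K {β} q) z) ⟩
        iter (F (pad K β')) z z + K  ≤⟨ iter-shift (F (pad K β')) (F β') K IH (F-mono β') z z ⟩
        iter (F β') z (z + K)        ≤⟨ iter-mono-count (F β') (F-infl β') (z + K) (m≤m+n z K) ⟩
        iter (F β') (z + K) (z + K)  ≡⟨ sym (F-succ β q (z + K)) ⟩
        F β (z + K)                  ∎
      where
        open ≤-Reasoning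
        K = suc k
        IH = go β' (rs (0 , step-succ q)) (transfinite-pred β t q) K
    ... | isLim =
      begin
        F (pad K β) z + K            ≡⟨ cong (_+ K) (F-lim (pad K β) (kind-pad-lim K {β} q) z) ⟩
        F (fs (pad K β) z) z + K     ≡⟨ cong (λ e → F e z + K) (fs-pad K {β} z q) ⟩
        F (pad K (fs β z)) z + K     ≤⟨ at-fs z ⟩
        F β (z + K)                  ∎
      where
        open ≤-Reasoning
        K = suc k
        at-fs : ∀ w → F (pad K (fs β w)) w + K ≤ F β (w + K)
        at-fs zero = ≤-trans (≤-reflexive (cong (_+ K) (F-pad-zero k (fs β 0)))) (F-infl β K)
        at-fs (suc w) with transfinite-fs β w t q
        ... | inj₁ refl = pad-absorb-ω K (suc w)
        ... | inj₂ t′ =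
          begin
            F (pad K (fs β (suc w))) (suc w) + K   ≤⟨ go (fs β (suc w)) (rs (suc w , step-lim q)) t′ K (suc w) ⟩
            F (fs β (suc w)) (suc w + K)           ≤⟨ F-descent (fs β (suc w + K))
                                                           (bachmann-chain {β} q (m≤m+n (suc w) K)) ⟩
            F (fs β (suc w + K)) (suc w + K)       ≡⟨ sym (F-lim β q (suc w + K)) ⟩
            F β (suc w + K)                        ∎

module Relativise (h : ℕ → ℕ) (p c : ℕ) (h-bound : ∀ x → h x + c ≤ F (nat p) (x + c)) where
  mutual
    fg-relative : ∀ {β x y} → FG h β x y → y + c ≤ F (pad p β) (x + c)
    fg-relative {x = x} fg-zero = ≡-subst (λ e → h x + c ≤ F e (x + c)) (sym (pad-𝟎 p)) (h-bound x)
    fg-relative {β} {x} {y} (fg-succ {β = β'} q it) =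
      begin
        y + c                                 ≤⟨ it-relative it ⟩
        iter (F (pad p β')) x (x + c)         ≤⟨ iter-mono-count (F (pad p β')) (F-infl (pad p β'))
                                                     (x + c) (m≤m+n x c) ⟩
        iter (F (pad p β')) (x + c) (x + c)   ≡⟨ sym (F-succ (pad p β) (kind-pad-succ p {β} q) (x + c)) ⟩
        F (pad p β) (x + c)                   ∎
      where open ≤-Reasoning
    fg-relative {β} {x} {y} (fg-lim q d) =
      begin
        y + c                             ≤⟨ fg-relative d ⟩
        F (pad p (fs β x)) (x + c)        ≤⟨ F-descent _ (chain-pad p (bachmann-chain {β} q (m≤m+n x c))) ⟩
        F (pad p (fs β (x + c))) (x + c)  ≡⟨ cong (λ e → F e (x + c)) (sym (fs-pad p {β} (x + c) q)) ⟩
        F (fs (pad p β) (x + c)) (x + c)  ≡⟨ sym (F-lim (pad p β) (kind-pad-lim p {β} q) (x + c)) ⟩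
        F (pad p β) (x + c)               ∎
      where open ≤-Reasoning

    it-relative : ∀ {β n a b} → It h β n a b → b + c ≤ iter (F (pad p β)) n (a + c)
    it-relative it-zero = ≤-refl
    it-relative {β} {suc n} (it-suc d i) =
      ≤-trans (it-relative i) (iter-mono (F (pad p β)) (F-mono (pad p β)) n (fg-relative d))

it-bound : ∀ {h β} Ψ → (∀ {a b} → FG h β a b → b ≤ Ψ a) → Mono Ψ →
           ∀ {n x y} → It h β n x y → y ≤ iter Ψ n x
it-bound Ψ B m it-zero = ≤-refl
it-bound Ψ B m {suc n} (it-suc d i) = ≤-trans (it-bound Ψ B m i) (iter-mono Ψ m n (B d))

module Closure (β : Ord) where
  F∈ : 𝓕 β {1} (λ v → F β (head v))
  F∈ = Fβ _ (F-graph-F β)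

  compose∈ : ∀ {g f : Vec ℕ 1 → ℕ} → 𝓕 β g → 𝓕 β f → 𝓕 β {1} (λ v → g (f v ∷ []))
  compose∈ g∈ f∈ = subst g∈ (λ _ → f∈)

  add-const∈ : ∀ K → 𝓕 β {1} (λ v → head v + K)
  add-const∈ K = ext (subst {hs = args} add args∈) (λ { (x ∷ []) → refl })
    where
      args : Fin 2 → Vec ℕ 1 → ℕ
      args zero       v = lookup v zero
      args (suc zero) v = K
      args∈ : ∀ i → 𝓕 β (args i)
      args∈ zero       = proj zero
      args∈ (suc zero) = const K

  iterate∈ : ∀ {g : Vec ℕ 1 → ℕ} → 𝓕 β g → ∀ K → 𝓕 β {1} (λ v → iter (λ x → g (x ∷ [])) K (head v))
  iterate∈ g∈ zero    = ext (proj zero) (λ { (x ∷ []) → refl })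
  iterate∈ g∈ (suc K) = ext (compose∈ (iterate∈ g∈ K) g∈) (λ { (x ∷ []) → refl })

  shiftedIter∈ : ∀ K → 𝓕 β {1} (λ v → shiftedIter β K (head v))
  shiftedIter∈ K = ext (compose∈ (iterate∈ F∈ K) (add-const∈ K)) (λ { (x ∷ []) → refl })

  shiftedF∈ : ∀ K → 𝓕 β {1} (λ v → F β (head v + K))
  shiftedF∈ K = compose∈ F∈ (add-const∈ K)

-- A monotone h eventually below some g ∈ 𝓕_β (β ≠ 𝟎) lies everywhere below a
-- shifted iterate of F_β: dominate g, then absorb the finitely many x < N into K.
control-bound : ∀ β → NZ β → (h : ℕ → ℕ) → Mono h →
                Σ (Vec ℕ 1 → ℕ) (λ g → 𝓕 β g × Σ ℕ (λ N → ∀ x → N ≤ x → h x ≤ g (x ∷ []))) →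
                Σ ℕ λ K → ∀ x → h x ≤ shiftedIter β K x
control-bound β nz h h-mono (g , g∈ , N , h≤g) = K , bound
  where
    open Domination β nz using (dominated)
    m = proj₁ (dominated g∈)
    K = m + h N + 1
    m≤K : m ≤ K
    m≤K = ≤-trans (m≤m+n m (h N)) (m≤m+n _ 1)
    bound : ∀ x → h x ≤ shiftedIter β K x
    bound x with ≤-total N x
    ... | inj₁ N≤x =
      begin
        h x                    ≤⟨ h≤g x N≤x ⟩
        g (x ∷ [])             ≤⟨ proj₂ (dominated g∈) (x ∷ []) ⟩
        shiftedIter β m (x + 0) ≡⟨ cong (shiftedIter β m) (+-identityʳ x) ⟩
        shiftedIter β m x      ≤⟨ shiftedIter-mono-count β x m≤K ⟩
        shiftedIter β K x      ∎
      where open ≤-Reasoning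
    ... | inj₂ x≤N =
      begin
        h x                ≤⟨ h-mono x≤N ⟩
        h N                ≤⟨ ≤-trans (m≤n+m (h N) m) (m≤m+n _ 1) ⟩
        K                  ≤⟨ m≤n+m K x ⟩
        x + K              ≤⟨ shiftedIter-infl β K x ⟩
        shiftedIter β K x  ∎
      where open ≤-Reasoning

iterate-shiftedIter : ∀ δ δ⁺ → kind δ⁺ ≡ isSucc δ → ∀ K x →
                      iter (shiftedIter δ K) x x ≤ shiftedIter δ⁺ (suc (suc (K + K))) x
iterate-shiftedIter δ δ⁺ q K zero = z≤n
iterate-shiftedIter δ δ⁺ q K x@(suc _) =
  begin
    iter Ψ x x                     ≤⟨ iter-compare Ψ Φ (K + K) Ψ≤Φ^2K (shiftedIter-mono δ K) (F-infl δ) x x 1≤x ⟩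
    iter Φ (x * (K + K)) x         ≤⟨ iter-mono₂ Φ (F-infl δ) (F-mono δ) x·2K≤z (m≤m+n x _) ⟩
    iter Φ z z                     ≡⟨ sym (F-succ δ⁺ q z) ⟩
    Φ⁺ z                           ≤⟨ F-mono δ⁺ (F-multiple≤iter δ⁺ (successor-nonzero δ⁺ q) (suc (K + K)) x) ⟩
    Φ⁺ (iter Φ⁺ (suc (K + K)) x)   ≡⟨ sym (iter-suc Φ⁺ (suc (K + K)) x) ⟩
    iter Φ⁺ L x                    ≤⟨ iter-mono Φ⁺ (F-mono δ⁺) L (m≤m+n x L) ⟩
    shiftedIter δ⁺ L x             ∎
  where
    open ≤-Reasoning
    Φ = F δ
    Φ⁺ = F δ⁺
    Ψ = shiftedIter δ K
    L = suc (suc (K + K))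
    z = suc (K + K) * x
    1≤x : 1 ≤ x
    1≤x = s≤s z≤n
    x·2K≤z : x * (K + K) ≤ z
    x·2K≤z = ≤-trans (≤-reflexive (*-comm x (K + K))) (m≤n+m _ x)
    Ψ≤Φ^2K : ∀ u → 1 ≤ u → Ψ u ≤ iter Φ (K + K) u
    Ψ≤Φ^2K u 1≤u = ≤-trans (iter-mono Φ (F-mono δ) K (iter-linear Φ (F-infl-pos δ) K u 1≤u))
                           (≤-reflexive (sym (iter-add Φ K K u)))

finite-level : ∀ γ (h : ℕ → ℕ) K₀ → (∀ x → h x ≤ shiftedIter γ K₀ x) → ∀ n →
               Σ ℕ λ K → ∀ {x y} → FG h (nat n) x y → y ≤ shiftedIter (γ ⊕ nat n) K x
finite-level γ h K₀ h≤ zero = K₀ , bound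
  where
    bound : ∀ {x y} → FG h 𝟎 x y → y ≤ shiftedIter (γ ⊕ 𝟎) K₀ x
    bound {x} fg-zero = ≡-subst (λ e → h x ≤ shiftedIter e K₀ x) (sym (⊕-identityʳ γ)) (h≤ x)
finite-level γ h K₀ h≤ (suc n) with finite-level γ h K₀ h≤ n
... | K , f≤ = suc (suc (K + K)) , bound
  where
    bound : ∀ {x y} → FG h (nat (suc n)) x y → y ≤ shiftedIter (γ ⊕ nat (suc n)) (suc (suc (K + K))) x
    bound {x} (fg-succ q it) with trans (sym q) (kind-nat n)
    ... | refl = ≤-trans (it-bound (shiftedIter (γ ⊕ nat n) K) f≤ (shiftedIter-mono (γ ⊕ nat n) K) it)
                         (iterate-shiftedIter (γ ⊕ nat n) (γ ⊕ nat (suc n)) (kind-⊕-nat γ n) K x)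
    bound (fg-lim q _) with trans (sym q) (kind-nat n)
    ... | ()

control-absorb : ∀ m K x → shiftedIter (nat m) K x + (K + 2) ≤ F (nat (2 + m)) (x + (K + 2))
control-absorb m K x =
  begin
    iter Fm K (x + K) + c          ≤⟨ +-monoˡ-≤ c (iter-mono-count Fm (F-infl (nat m)) (x + K) (m≤n+m K x)) ⟩
    iter Fm (x + K) (x + K) + c    ≡⟨ cong (_+ c) (sym (F-succ (nat (suc m)) (kind-nat m) (x + K))) ⟩
    Fm⁺ (x + K) + c                ≤⟨ +-mono-≤ (F-mono (nat (suc m)) (+-monoʳ-≤ x (m≤m+n K 2))) (m≤n+m c x) ⟩
    Fm⁺ (x + c) + (x + c)          ≤⟨ +-monoʳ-≤ (Fm⁺ (x + c)) (F-infl (nat (suc m)) (x + c)) ⟩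
    Fm⁺ (x + c) + Fm⁺ (x + c)      ≤⟨ F-double (nat (suc m)) tt _ ⟩
    iter Fm⁺ 2 (x + c)             ≤⟨ iter-mono-count Fm⁺ (F-infl (nat (suc m))) (x + c) 2≤x+c ⟩
    iter Fm⁺ (x + c) (x + c)       ≡⟨ sym (F-succ (nat (2 + m)) (kind-nat (suc m)) (x + c)) ⟩
    F (nat (2 + m)) (x + c)        ∎
  where
    open ≤-Reasoning
    c = K + 2
    Fm = F (nat m)
    Fm⁺ = F (nat (suc m))
    2≤x+c : 2 ≤ x + c
    2≤x+c = ≤-trans (m≤n+m 2 K) (m≤n+m c x)

-- Part (ii): from h ≤ shiftedIter m K with m finite, every transfinite level
-- f_α is bounded by a shift of F_α: relativise to F_{p+α}, then absorb the padding p.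
transfinite-level : ∀ m (h : ℕ → ℕ) K → (∀ x → h x ≤ shiftedIter (nat m) K x) →
                    ∀ α → Transfinite α → ∀ x y → FG h α x y → y ≤ F α (x + (K + 2 + (2 + m)))
transfinite-level m h K h≤ α t x y fα =
  begin
    y                        ≤⟨ m≤m+n y c ⟩
    y + c                    ≤⟨ fg-relative fα ⟩
    F (pad p α) (x + c)      ≤⟨ m≤m+n _ p ⟩
    F (pad p α) (x + c) + p  ≤⟨ pad-absorb α t p (x + c) ⟩
    F α (x + c + p)          ≡⟨ cong (F α) (+-assoc x c p) ⟩
    F α (x + (c + p))        ∎
  where
    open ≤-Reasoning
    c = K + 2
    p = 2 + m
    open Relativise h p c (λ x → ≤-trans (+-monoˡ-≤ c (h≤ x)) (control-absorb m K x))

lemma15 : (γ α : Ord) → IsNF γ → IsNF α → 𝟎 <ₒ γ →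
          (h : ℕ → ℕ) → (∀ {x y} → x ≤ y → h x ≤ h y) →
          Σ (Vec ℕ 1 → ℕ) (λ g → 𝓕 γ g × Σ ℕ (λ N → ∀ x → N ≤ x → h x ≤ g (x ∷ []))) →
          ((α <ₒ ω → BoundedIn h α (γ ⊕ α))
           × (γ <ₒ ω → ω ≤ₒ α → BoundedIn h α α))
lemma15 γ α γ-nf α-nf 0<γ h h-mono h-eventually = bounded-finite , bounded-transfinite
  where
    control : Σ ℕ λ K → ∀ x → h x ≤ shiftedIter γ K x
    control = control-bound γ (positive-nonzero γ 0<γ) h h-mono h-eventually

    bounded-finite : α <ₒ ω → BoundedIn h α (γ ⊕ α)
    bounded-finite α<ω with finite-below-ω α α-nf α<ω
    ... | n , refl with finite-level γ h (proj₁ control) (proj₂ control) n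
    ... | K , f≤ = _ , Closure.shiftedIter∈ (γ ⊕ nat n) K , λ x y → f≤

    bounded-transfinite : γ <ₒ ω → ω ≤ₒ α → BoundedIn h α α
    bounded-transfinite γ<ω ω≤α with finite-below-ω γ γ-nf γ<ω
    ... | m , refl =
      _ , Closure.shiftedF∈ α _ ,
      transfinite-level m h (proj₁ control) (proj₂ control) α (ω≤⇒transfinite α ω≤α)
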